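{- Let $p$ be an odd prime, $k$ an algebraically closed field of characteristic $p$, and $d=p^2-1$. Let $X\to\mathbb P^1$ be the Artin–Schreier cover defined by $y^p-y=-x^{d}-x^{d/2}$. Let $0\le k'<\frac{p-1}{2}$ and $0\le l\le \frac{d(p/2-1-k')-p}{p}$ be integers. Then there exists $y^mx^n\,dx\in\mathcal B_X$ with $m<\frac{p-1}{2}$ such that the largest term of $\mathcal C_X(y^mx^n\,dx)$ (when written in the basis $\mathcal B_X$, with respect to the order below) is $y^{k'}x^{l}\,dx$.
   Context: An Artin–Schreier cover is a $\mathbb Z/p\mathbb Z$-Galois cover $X\to\mathbb P^1$ of smooth projective connected curves over $k$, given by an equation $y^p-y=f(x)$. For $f\in k[x]$ of degree $d$ prime to $p$, the set $\mathcal B_X=\{y^ix^j\,dx:\ 0\le i\le p-2,\ 0\le j\le \lceil (p-i-1)d/p\rceil-2\}$ is a $k$-basis of $H^0(X,\Omega^1_X)$. $\mathcal C_X$ is the Cartier operator on $H^0(X,\Omega^1_X)$, the $p^{ -1}$-semilinear map with $\mathcal C_X(f^p\alpha+\beta)=f\,\mathcal C_X(\alpha)+\mathcal C_X(\beta)$, $\mathcal C_X(x^{p-1}dx)=dx$, and $\mathcal C_X(x^ndx)=0$ for $n\not\equiv-1\pmod p$. $\mathcal B_X$ is ordered lexicographically with $y>x$: $y^ix^jdx>y^ax^bdx$ iff $i>a$, or $i=a$ and $j>b$. -}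

module Defs where

open import Data.Nat using (ℕ; zero; suc; _+_; _*_; _∸_; _^_; _≤_; _<_; _≟_; NonZero; ⌊_/2⌋)
open import Data.Nat.DivMod using (_/_)
open import Data.Nat.Combinatorics using (_C_)
open import Data.Bool using (if_then_else_)
open import Data.Product using (_×_; _,_)
open import Data.Nat.Divisibility using (_∣_)
open import Relation.Nullary using (¬_)
open import Data.Sum using (_⊎_)
open import Relation.Nullary.Decidable using (⌊_⌋)
open import Relation.Binary.PropositionalEquality using (_≡_)

sumTo : ℕ → (ℕ → ℕ) → ℕ
sumTo zero    f = f 0
sumTo (suc n) f = sumTo n f + f (suc n)

δ : ℕ → ℕ → ℕ
δ x y = if ⌊ x ≟ y ⌋ then 1 else 0

ceilDiv : ℕ → (q : ℕ) → .{{NonZero q}} → ℕ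
ceilDiv a q = (a + (q ∸ 1)) / q

-- y^i x^j dx ∈ 𝓑_X  for  y^p - y = f(x), deg f = d:
--   0 ≤ i ≤ p-2  and  0 ≤ j ≤ ⌈(p-i-1)d/p⌉ - 2
InBasis : (p : ℕ) → .{{NonZero p}} → (d i j : ℕ) → Set
InBasis p d i j = (i ≤ p ∸ 2) × (j + 2 ≤ ceilDiv ((p ∸ i ∸ 1) * d) p)

-- Here f(x) = -x^d - x^{d/2}, so -f = x^d + x^{d/2}, which has coefficients in 𝔽_p.
-- Coefficient of x^N in (-f)^j = (x^d + x^{d/2})^j  (as an integer; reduce mod p).
negfPowCoeff : (d j N : ℕ) → ℕ
negfPowCoeff d j N = sumTo j (λ t → (j C t) * δ (d * t + ⌊ d /2⌋ * (j ∸ t)) N)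

-- Coefficient of x^b dx in 𝓒(x^N dx):  𝓒(x^{pq + p - 1} dx) = x^q dx, else 0.
cartierMonoCoeff : (p N b : ℕ) → ℕ
cartierMonoCoeff p N b = δ (N + 1) (p * (b + 1))

-- Coefficient (an integer, to be read mod p, i.e. in 𝔽_p ⊆ k) of y^a x^b dx in
-- 𝓒_X(y^m x^n dx), computed from the defining rules of 𝓒_X:
--   y = y^p - f, so y^m x^n dx = Σ_a (m C a) (y^a)^p (-f)^{m-a} x^n dx, and
--   𝓒_X(y^m x^n dx) = Σ_a (m C a) y^a 𝓒((-f)^{m-a} x^n dx)
-- (all scalars lie in 𝔽_p, so p^{-1}-semilinearity acts trivially on them).
-- The exponents N of (-f)^{m-a} are at most d*m.
CartierCoeff : (p d m n a b : ℕ) → ℕ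
CartierCoeff p d m n a b =
  (m C a) * sumTo (d * m) (λ N → negfPowCoeff d (m ∸ a) N * cartierMonoCoeff p (N + n) b)

-- lexicographic order on y^i x^j dx with y > x : (a,b) ≤ (k,l)
_≤lex_ : ℕ × ℕ → ℕ × ℕ → Set
_≤lex_ (a , b) (k , l) = (a < k) ⊎ ((a ≡ k) × (b ≤ l))

Occurs : (p d m n a b : ℕ) → Set
Occurs p d m n a b = ¬ (p ∣ CartierCoeff p d m n a b)

LargestTerm : (p d m n k l : ℕ) → Set
LargestTerm p d m n k l =
  Occurs p d m n k l × (∀ a b → Occurs p d m n a b → (a , b) ≤lex (k , l))

{-# OPTIONS --safe #-}
module Submission where

-- For odd p put H = (p² − 1)/2, so d = 2H and (−f)^i = (x^{2H} + x^H)^i = Σ_t C(i,t) x^{H(i+t)}.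
-- Hence y^a x^b dx occurs in C(y^m x^n dx) only through summands with a + i = m, t ≤ i and
-- H(i+t) + n + 1 = p(b+1).  Since 2H ≡ −1 (mod p) and i + t ≤ 2m < p, this equation determines
-- i + t and b.  Writing p(l+1) − 1 = Hs + n with n < H and taking m = k′ + ⌈s/2⌉, every term
-- therefore has b = l and i ≥ ⌈s/2⌉, i.e. a ≤ k′, while y^{k′}x^l dx itself has coefficient
-- C(m,k′)·C(⌈s/2⌉,⌊s/2⌋), a unit mod p because m < p.

open import Defs
open import Data.Nat using (ℕ; NonZero; _+_; _*_; _∸_; _^_; _≤_; _<_)
open import Data.Nat.Primality using (Prime)
open import Data.Product using (Σ; _×_)
open import Relation.Binary.PropositionalEquality using (_≢_)

open import Data.Nat using (zero; suc; _≟_; _!; ⌊_/2⌋; ⌈_/2⌉; z≤n; s≤s; pred; >-nonZero; nonTrivial⇒n>1; _≤?_)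
open import Data.Nat.Properties
open import Data.Nat.DivMod
open import Data.Nat.Divisibility using (_∣_; _∤_; divides; ∣-trans; _∣0; m/n∣m; n∣m*n; >⇒∤)
open import Data.Nat.Combinatorics using (_C_; nCk≡n!/k![n-k]!; k>n⇒nCk≡0; k![n∸k]!∣n!)
open import Data.Nat.Primality using (euclidsLemma; prime⇒irreducible; prime⇒nonTrivial)
open import Data.Nat.Tactic.RingSolver using (solve-∀)
open import Data.Product using (∃; ∃₂; _,_; proj₁; proj₂)
open import Data.Sum using (inj₁; inj₂)
open import Relation.Nullary using (yes; no; contradiction)
open import Relation.Binary.PropositionalEquality
  using (_≡_; refl; sym; trans; cong; cong₂; subst; subst₂; ≢-sym; module ≡-Reasoning)

δ-refl : ∀ x → δ x x ≡ 1
δ-refl x with x ≟ x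
... | yes _   = refl
... | no x≢x = contradiction refl x≢x

δ-≢ : ∀ {x y} → x ≢ y → δ x y ≡ 0
δ-≢ {x} {y} x≢y with x ≟ y
... | yes x≡y = contradiction x≡y x≢y
... | no _    = refl

δ≢0⇒≡ : ∀ x y → δ x y ≢ 0 → x ≡ y
δ≢0⇒≡ x y δ≢0 with x ≟ y
... | yes x≡y = x≡y
... | no _    = contradiction refl δ≢0

m*n≢0⇒m≢0×n≢0 : ∀ m n → m * n ≢ 0 → m ≢ 0 × n ≢ 0
m*n≢0⇒m≢0×n≢0 m n mn≢0 = (λ m≡0 → mn≢0 (cong (_* n) m≡0))
                       , (λ n≡0 → mn≢0 (trans (cong (m *_) n≡0) (*-zeroʳ m)))

sumTo-≡0 : ∀ n f → (∀ i → i ≤ n → f i ≡ 0) → sumTo n f ≡ 0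
sumTo-≡0 zero    f f≡0 = f≡0 0 z≤n
sumTo-≡0 (suc n) f f≡0 =
  cong₂ _+_ (sumTo-≡0 n f (λ i i≤n → f≡0 i (m≤n⇒m≤1+n i≤n))) (f≡0 (suc n) ≤-refl)

sumTo-single : ∀ n f {i} → i ≤ n → (∀ j → j ≢ i → f j ≡ 0) → sumTo n f ≡ f i
sumTo-single zero f z≤n _ = refl
sumTo-single (suc n) f {i} i≤1+n f≡0 with i ≟ suc n
... | yes refl = cong (_+ f (suc n)) (sumTo-≡0 n f (λ j j≤n → f≡0 j (<⇒≢ (s≤s j≤n))))
... | no i≢1+n = begin
  sumTo n f + f (suc n) ≡⟨ cong (sumTo n f +_) (f≡0 (suc n) (≢-sym i≢1+n)) ⟩
  sumTo n f + 0         ≡⟨ +-identityʳ _ ⟩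
  sumTo n f             ≡⟨ sumTo-single n f (≤-pred (≤∧≢⇒< i≤1+n i≢1+n)) f≡0 ⟩
  f i                   ∎
  where open ≡-Reasoning

sumTo≢0⇒∃ : ∀ n f → sumTo n f ≢ 0 → ∃ λ i → i ≤ n × f i ≢ 0
sumTo≢0⇒∃ zero    f f0≢0 = 0 , z≤n , f0≢0
sumTo≢0⇒∃ (suc n) f sum≢0 with f (suc n) ≟ 0
... | no fn≢0 = suc n , ≤-refl , fn≢0
... | yes fn≡0 with sumTo≢0⇒∃ n f (λ sum≡0 → sum≢0 (cong₂ _+_ sum≡0 fn≡0))
...   | i , i≤n , fi≢0 = i , m≤n⇒m≤1+n i≤n , fi≢0

prime∤n! : ∀ {p n} → Prime p → n < p → p ∤ n !
prime∤n! {n = zero}  pp _   = >⇒∤ (nonTrivial⇒n>1 _ {{prime⇒nonTrivial pp}})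
prime∤n! {n = suc n} pp n<p p∣n! with euclidsLemma (suc n) (n !) pp p∣n!
... | inj₁ p∣1+n = >⇒∤ n<p p∣1+n
... | inj₂ p∣n!  = prime∤n! pp (<⇒≤ n<p) p∣n!

nCk∣n! : ∀ {n k} → k ≤ n → n C k ∣ n !
nCk∣n! {n} {k} k≤n = subst (_∣ n !) (sym (nCk≡n!/k![n-k]! k≤n)) (m/n∣m (k![n∸k]!∣n! k≤n))
  where instance _ = k !* (n ∸ k) !≢0

prime∤nCk : ∀ {p n k} → Prime p → n < p → k ≤ n → p ∤ n C k
prime∤nCk pp n<p k≤n p∣nCk = prime∤n! pp n<p (∣-trans p∣nCk (nCk∣n! k≤n))

prime∤* : ∀ {p m n} → Prime p → p ∤ m → p ∤ n → p ∤ m * n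
prime∤* {m = m} {n} pp p∤m p∤n p∣mn with euclidsLemma m n pp p∣mn
... | inj₁ p∣m = p∤m p∣m
... | inj₂ p∣n = p∤n p∣n

[m+kn]/n≡k : ∀ {m} k n .{{_ : NonZero n}} → m < n → (m + k * n) / n ≡ k
[m+kn]/n≡k {m} k n m<n = begin
  (m + k * n) / n     ≡⟨ +-distrib-/-∣ʳ m (n∣m*n k) ⟩
  m / n + k * n / n   ≡⟨ cong₂ _+_ (m<n⇒m/n≡0 m<n) (m*n/n≡m k n) ⟩
  k                   ∎
  where open ≡-Reasoning

divMod-unique : ∀ {a b} X Y n .{{_ : NonZero n}} → a < n → b < n →
                a + X * n ≡ b + Y * n → a ≡ b × X ≡ Y
divMod-unique {a} {b} X Y n a<n b<n eq = a≡b , X≡Y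
  where
  X≡Y : X ≡ Y
  X≡Y = trans (sym ([m+kn]/n≡k X n a<n)) (trans (cong (_/ n) eq) ([m+kn]/n≡k Y n b<n))
  a≡b : a ≡ b
  a≡b = +-cancelʳ-≡ (X * n) a b (trans eq (cong (λ Z → b + Z * n) (sym X≡Y)))

⌈[i+t]/2⌉≤i : ∀ {i t} → t ≤ i → ⌈ i + t /2⌉ ≤ i
⌈[i+t]/2⌉≤i {i} t≤i = subst (⌈ i + _ /2⌉ ≤_) (sym (n≡⌈n+n/2⌉ i)) (⌈n/2⌉-mono (+-monoʳ-≤ i t≤i))

⌈n/2⌉+⌈n/2⌉≤1+n : ∀ n → ⌈ n /2⌉ + ⌈ n /2⌉ ≤ suc n
⌈n/2⌉+⌈n/2⌉≤1+n zero = z≤n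
⌈n/2⌉+⌈n/2⌉≤1+n (suc zero) = s≤s (s≤s z≤n)
⌈n/2⌉+⌈n/2⌉≤1+n (suc (suc n)) = s≤s (subst (_≤ suc (suc n)) (sym (+-suc _ _)) (s≤s (⌈n/2⌉+⌈n/2⌉≤1+n n)))

negfPow-exponent : ∀ H {i t} → t ≤ i → (H + H) * t + ⌊ H + H /2⌋ * (i ∸ t) ≡ H * (i + t)
negfPow-exponent H {t = t} t≤i with m≤n⇒∃[o]m+o≡n t≤i
... | u , refl rewrite sym (n≡⌊n+n/2⌋ H) | m+n∸m≡n t u = identity H t u
  where
  identity : ∀ H t u → (H + H) * t + H * u ≡ H * (t + u + t)
  identity = solve-∀

negfPowCoeff-≢0 : ∀ H i N → negfPowCoeff (H + H) i N ≢ 0 → ∃ λ t → t ≤ i × H * (i + t) ≡ N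
negfPowCoeff-≢0 H i N c≢0 with sumTo≢0⇒∃ i _ c≢0
... | t , t≤i , term≢0 =
  t , t≤i , trans (sym (negfPow-exponent H t≤i)) (δ≢0⇒≡ _ N (proj₂ (m*n≢0⇒m≢0×n≢0 (i C t) _ term≢0)))

negfPowCoeff-at : ∀ H .{{_ : NonZero H}} {i t} → t ≤ i → negfPowCoeff (H + H) i (H * (i + t)) ≡ i C t
negfPowCoeff-at H {i} {t} t≤i = begin
  negfPowCoeff (H + H) i (H * (i + t)) ≡⟨ sumTo-single i term t≤i others ⟩
  term t                               ≡⟨ cong ((i C t) *_) (subst (λ e → δ e (H * (i + t)) ≡ 1) (sym (negfPow-exponent H t≤i)) (δ-refl _)) ⟩
  (i C t) * 1                          ≡⟨ *-identityʳ _ ⟩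
  i C t                                ∎
  where
  open ≡-Reasoning
  term : ℕ → ℕ
  term t′ = (i C t′) * δ ((H + H) * t′ + ⌊ H + H /2⌋ * (i ∸ t′)) (H * (i + t))
  others : ∀ t′ → t′ ≢ t → term t′ ≡ 0
  others t′ t′≢t with t′ ≤? i
  ... | no t′≰i rewrite k>n⇒nCk≡0 (≰⇒> t′≰i) = refl
  ... | yes t′≤i = trans (cong ((i C t′) *_) (δ-≢ exponents-differ)) (*-zeroʳ (i C t′))
    where
    exponents-differ : (H + H) * t′ + ⌊ H + H /2⌋ * (i ∸ t′) ≢ H * (i + t)
    exponents-differ eq = t′≢t (+-cancelˡ-≡ i t′ t (*-cancelˡ-≡ (i + t′) (i + t) H (trans (sym (negfPow-exponent H t′≤i)) eq)))

CartierCoeff-≢0 : ∀ p H m n a b → CartierCoeff p (H + H) m n a b ≢ 0 →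
                  ∃₂ λ i t → a + i ≡ m × t ≤ i × H * (i + t) + n + 1 ≡ p * (b + 1)
CartierCoeff-≢0 p H m n a b c≢0
  with mCa≢0 , sum≢0 ← m*n≢0⇒m≢0×n≢0 (m C a) _ c≢0
  with N , _ , term≢0 ← sumTo≢0⇒∃ ((H + H) * m) _ sum≢0
  with f≢0 , δ≢0 ← m*n≢0⇒m≢0×n≢0 (negfPowCoeff (H + H) (m ∸ a) N) _ term≢0
  with t , t≤i , exponent≡N ← negfPowCoeff-≢0 H (m ∸ a) N f≢0
  = m ∸ a , t , m+[n∸m]≡n a≤m , t≤i
  , subst (λ e → e + n + 1 ≡ p * (b + 1)) (sym exponent≡N) (δ≢0⇒≡ _ _ δ≢0)
  where
  a≤m : a ≤ m
  a≤m = ≮⇒≥ (λ m<a → mCa≢0 (k>n⇒nCk≡0 m<a))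

CartierCoeff-at : ∀ p H .{{_ : NonZero H}} {n a b i t} → t ≤ i → H * (i + t) + n + 1 ≡ p * (b + 1) →
                  CartierCoeff p (H + H) (a + i) n a b ≡ ((a + i) C a) * (i C t)
CartierCoeff-at p H {n} {a} {b} {i} {t} t≤i exponent = cong (((a + i) C a) *_) (begin
  sumTo ((H + H) * (a + i)) term ≡⟨ sumTo-single _ term exponent≤bound others ⟩
  term (H * (i + t))             ≡⟨ cong₂ _*_ (trans (cong (λ j → negfPowCoeff (H + H) j (H * (i + t))) (m+n∸m≡n a i))
                                                     (negfPowCoeff-at H t≤i))
                                              (subst (λ e → δ e (p * (b + 1)) ≡ 1) (sym exponent) (δ-refl _)) ⟩
  (i C t) * 1                    ≡⟨ *-identityʳ _ ⟩
  i C t                          ∎)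
  where
  open ≡-Reasoning
  term : ℕ → ℕ
  term N = negfPowCoeff (H + H) (a + i ∸ a) N * cartierMonoCoeff p (N + n) b
  exponent≤bound : H * (i + t) ≤ (H + H) * (a + i)
  exponent≤bound = subst (H * (i + t) ≤_)
    (trans (*-distribˡ-+ H (a + i) (a + i)) (sym (*-distribʳ-+ (a + i) H H)))
    (*-monoʳ-≤ H (+-mono-≤ (m≤n+m i a) (≤-trans t≤i (m≤n+m i a))))
  others : ∀ N → N ≢ H * (i + t) → term N ≡ 0
  others N N≢exponent = trans (cong (negfPowCoeff (H + H) (a + i ∸ a) N *_) (δ-≢ λ eq →
      N≢exponent (+-cancelʳ-≡ n _ _ (+-cancelʳ-≡ 1 _ _ (trans eq (sym exponent))))))
    (*-zeroʳ (negfPowCoeff (H + H) (a + i ∸ a) N))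

exponent-unique : ∀ {p H σ s n b b′} .{{_ : NonZero p}} → p * p ≡ suc (H + H) → σ < p → s < p →
                  H * σ + n + 1 ≡ p * (b + 1) → H * s + n + 1 ≡ p * (b′ + 1) → σ ≡ s × b ≡ b′
exponent-unique {p} {H} {σ} {s} {n} {b} {b′} p*p≡1+2H σ<p s<p eq eq′ =
  sym s≡σ , +-cancelʳ-≡ 1 b b′ (*-cancelˡ-≡ (b + 1) (b′ + 1) 2 (+-cancelˡ-≡ (p * s) _ _ (sym ps+2b′≡ps+2b)))
  where
  open ≡-Reasoning
  expand : ∀ p x y z → x + (p * y + 2 * z) * p ≡ x + y * (p * p) + 2 * (p * z)
  expand = solve-∀
  swap : ∀ H n x y → x + y * suc (H + H) + 2 * (H * x + n + 1) ≡ y + x * suc (H + H) + 2 * (H * y + n + 1)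
  swap = solve-∀
  crossed : s + (p * σ + 2 * (b′ + 1)) * p ≡ σ + (p * s + 2 * (b + 1)) * p
  crossed = begin
    s + (p * σ + 2 * (b′ + 1)) * p            ≡⟨ expand p s σ (b′ + 1) ⟩
    s + σ * (p * p) + 2 * (p * (b′ + 1))      ≡⟨ cong₂ (λ x y → s + σ * x + 2 * y) p*p≡1+2H (sym eq′) ⟩
    s + σ * suc (H + H) + 2 * (H * s + n + 1) ≡⟨ swap H n s σ ⟩
    σ + s * suc (H + H) + 2 * (H * σ + n + 1) ≡⟨ cong₂ (λ x y → σ + s * x + 2 * y) (sym p*p≡1+2H) eq ⟩
    σ + s * (p * p) + 2 * (p * (b + 1))       ≡⟨ expand p σ s (b + 1) ⟨
    σ + (p * s + 2 * (b + 1)) * p             ∎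
  quotients : s ≡ σ × p * σ + 2 * (b′ + 1) ≡ p * s + 2 * (b + 1)
  quotients = divMod-unique (p * σ + 2 * (b′ + 1)) (p * s + 2 * (b + 1)) p s<p σ<p crossed
  s≡σ : s ≡ σ
  s≡σ = proj₁ quotients
  ps+2b′≡ps+2b : p * s + 2 * (b′ + 1) ≡ p * s + 2 * (b + 1)
  ps+2b′≡ps+2b = subst (λ x → p * x + 2 * (b′ + 1) ≡ p * s + 2 * (b + 1)) (sym s≡σ) (proj₂ quotients)

ceilDiv-*-pred-square : ∀ {p H w} .{{_ : NonZero p}} → p * p ≡ suc (H + H) → w < p →
                        ceilDiv (w * (H + H)) p ≡ w * p
ceilDiv-*-pred-square {p@(suc r)} {H} {w} p*p≡1+2H (s≤s w≤r) with u , refl ← m≤n⇒∃[o]m+o≡n w≤r = begin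
  (w * (H + H) + (w + u)) / p   ≡⟨ cong (_/ p) (rearrange H w u) ⟩
  (u + w * suc (H + H)) / p     ≡⟨ cong (λ x → (u + w * x) / p) p*p≡1+2H ⟨
  (u + w * (p * p)) / p         ≡⟨ cong (λ x → (u + x) / p) (*-assoc w p p) ⟨
  (u + w * p * p) / p           ≡⟨ [m+kn]/n≡k (w * p) p (s≤s (m≤n+m u w)) ⟩
  w * p                         ∎
  where
  open ≡-Reasoning
  rearrange : ∀ H w u → w * (H + H) + (w + u) ≡ u + w * suc (H + H)
  rearrange = solve-∀

2*m<p∸1⇒2+m+m≤p : ∀ {m p} → 2 * m < p ∸ 1 → suc m + suc m ≤ p
2*m<p∸1⇒2+m+m≤p {m} {suc r} 2m<r = s≤s (subst (_≤ r) (trans (cong suc (cong (m +_) (+-identityʳ m))) (sym (+-suc m m))) 2m<r)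

H<[p∸m∸1]*p : ∀ {p H m} → p * p ≡ suc (H + H) → 2 * m < p ∸ 1 → H < (p ∸ m ∸ 1) * p
H<[p∸m∸1]*p {p} {H} {m} p*p≡1+2H 2m<p∸1 = *-cancelˡ-< 2 H (w * p) (begin-strict
  2 * H         <⟨ subst (2 * H <_) 1+2*H≡p*p (n<1+n (2 * H)) ⟩
  p * p         ≤⟨ *-monoˡ-≤ p p≤w+w ⟩
  (w + w) * p   ≡⟨ *-distribʳ-+ p w w ⟩
  w * p + w * p ≡⟨ double (w * p) ⟨
  2 * (w * p)   ∎)
  where
  open ≤-Reasoning
  w : ℕ
  w = p ∸ m ∸ 1
  double : ∀ x → 2 * x ≡ x + x
  double = solve-∀
  1+2*H≡p*p : suc (2 * H) ≡ p * p
  1+2*H≡p*p = trans (cong suc (double H)) (sym p*p≡1+2H)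
  p≤w+w : p ≤ w + w
  p≤w+w = begin
    p                           ≡⟨ m∸n+n≡m (m+n≤o⇒m≤o (suc m) 2+m+m≤p) ⟨
    p ∸ suc m + suc m           ≤⟨ +-monoʳ-≤ (p ∸ suc m) (m+n≤o⇒m≤o∸n (suc m) 2+m+m≤p) ⟩
    p ∸ suc m + (p ∸ suc m)     ≡⟨ cong (λ x → x + x) (trans (∸-+-assoc p m 1) (cong (p ∸_) (+-comm m 1))) ⟨
    w + w                       ∎
    where
    2+m+m≤p : suc m + suc m ≤ p
    2+m+m≤p = 2*m<p∸1⇒2+m+m≤p 2m<p∸1

InBasis-intro : ∀ {p H m n} .{{_ : NonZero p}} → p * p ≡ suc (H + H) → 2 * m < p ∸ 1 → n < H →
                InBasis p (H + H) m n
InBasis-intro {p@(suc r)} {H} {m} {n} p*p≡1+2H 2m<p∸1 n<H = m≤p∸2 , n+2≤ceilDiv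
  where
  m≤p∸2 : m ≤ p ∸ 2
  m≤p∸2 = m+n≤o⇒m≤o∸n m {2} (begin
    m + 2         ≡⟨ +-comm m 2 ⟩
    2 + m         ≤⟨ s≤s (m≤n+m (suc m) m) ⟩
    suc m + suc m ≤⟨ 2*m<p∸1⇒2+m+m≤p {m} {p} 2m<p∸1 ⟩
    p             ∎)
    where open ≤-Reasoning
  w<p : p ∸ m ∸ 1 < p
  w<p = s≤s (∸-monoˡ-≤ 1 (m∸n≤m p m))
  n+2≤ceilDiv : n + 2 ≤ ceilDiv ((p ∸ m ∸ 1) * (H + H)) p
  n+2≤ceilDiv = subst (n + 2 ≤_) (sym (ceilDiv-*-pred-square {p} {H} p*p≡1+2H w<p))
    (≤-trans (≤-reflexive (+-comm n 2)) (≤-trans (s≤s n<H) (H<[p∸m∸1]*p {p} {H} {m} p*p≡1+2H 2m<p∸1)))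

2*[k+⌈s/2⌉]<p∸1 : ∀ {p k s} → 2 * k < p ∸ 1 → s < p ∸ (2 + 2 * k) → 2 * (k + ⌈ s /2⌉) < p ∸ 1
2*[k+⌈s/2⌉]<p∸1 {suc r} {k} {s} 2k<r s<r∸[1+2k] = begin-strict
  2 * (k + ⌈ s /2⌉)          ≡⟨ distribute k ⌈ s /2⌉ ⟩
  2 * k + (⌈ s /2⌉ + ⌈ s /2⌉) ≤⟨ +-monoʳ-≤ (2 * k) (⌈n/2⌉+⌈n/2⌉≤1+n s) ⟩
  2 * k + suc s              <⟨ s≤s (≤-reflexive (trans (+-comm (2 * k) (suc s)) (sym (+-suc s (2 * k))))) ⟩
  suc s + suc (2 * k)        ≤⟨ m≤o∸n⇒m+n≤o (suc s) 2k<r s<r∸[1+2k] ⟩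
  r                          ∎
  where
  open ≤-Reasoning
  distribute : ∀ k j → 2 * (k + j) ≡ 2 * k + (j + j)
  distribute = solve-∀

≤×≡⇒≤lex : ∀ {a b k l} → a ≤ k → b ≡ l → (a , b) ≤lex (k , l)
≤×≡⇒≤lex a≤k b≡l with m≤n⇒m<n∨m≡n a≤k
... | inj₁ a<k = inj₁ a<k
... | inj₂ a≡k = inj₂ (a≡k , ≤-reflexive b≡l)

odd-prime-square : ∀ {p} → Prime p → p ≢ 2 → ∃ λ H → NonZero H × p * p ≡ suc (H + H)
odd-prime-square {p} pp p≢2 with p % 2 | m≡m%n+[m/n]*n p 2 | m%n<n p 2
... | 0 | p≡[p/2]*2 | _ with prime⇒irreducible pp (divides (p / 2) p≡[p/2]*2)
...   | inj₁ ()
...   | inj₂ 2≡p = contradiction (sym 2≡p) p≢2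
odd-prime-square {p} pp p≢2 | suc (suc _) | _ | s≤s (s≤s ())
odd-prime-square {p} pp p≢2 | 1 | p≡1+[p/2]*2 | _ with p / 2
... | zero   = contradiction (nonTrivial⇒n>1 p {{prime⇒nonTrivial pp}}) (<-irrefl (sym p≡1+[p/2]*2))
... | suc q′ = H , _ , subst (λ x → x * x ≡ suc (H + H)) (sym p≡1+[p/2]*2) (square q)
  where
  q H : ℕ
  q = suc q′
  H = q * (2 + q * 2)
  square : ∀ q → suc (q * 2) * suc (q * 2) ≡ suc (q * (2 + q * 2) + q * (2 + q * 2))
  square = solve-∀

module LargestTermWitness
  {p H : ℕ} .{{_ : NonZero p}} .{{_ : NonZero H}} (pp : Prime p) (p*p≡1+2H : p * p ≡ suc (H + H))
  {k′ l : ℕ} (2k′<p∸1 : 2 * k′ < p ∸ 1) (bound : 2 * p * (l + 1) ≤ (H + H) * (p ∸ (2 + 2 * k′)))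
  where

  s n j m : ℕ
  s = pred (p * (l + 1)) / H
  n = pred (p * (l + 1)) % H
  j = ⌈ s /2⌉
  m = k′ + j

  Hs+n+1≡p[l+1] : H * s + n + 1 ≡ p * (l + 1)
  Hs+n+1≡p[l+1] = begin
    H * s + n + 1          ≡⟨ shuffle H s n ⟩
    suc (n + s * H)        ≡⟨ cong suc (m≡m%n+[m/n]*n (pred (p * (l + 1))) H) ⟨
    suc (pred (p * (l + 1))) ≡⟨ suc-pred (p * (l + 1)) ⟩
    p * (l + 1)            ∎
    where
    open ≡-Reasoning
    instance
      l+1≢0 : NonZero (l + 1)
      l+1≢0 = >-nonZero (m≤n+m 1 l)
      p[l+1]≢0 : NonZero (p * (l + 1))
      p[l+1]≢0 = m*n≢0 p (l + 1)
    shuffle : ∀ H s n → H * s + n + 1 ≡ suc (n + s * H)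
    shuffle = solve-∀

  s<p∸[2+2k′] : s < p ∸ (2 + 2 * k′)
  s<p∸[2+2k′] = *-cancelˡ-< H s _ (begin-strict
    H * s                    <⟨ ≤-<-trans (m≤m+n (H * s) n) (m<m+n (H * s + n) (s≤s z≤n)) ⟩
    H * s + n + 1            ≡⟨ Hs+n+1≡p[l+1] ⟩
    p * (l + 1)              ≤⟨ *-cancelˡ-≤ 2 (subst₂ _≤_ (*-assoc 2 p (l + 1)) (double-* H _) bound) ⟩
    H * (p ∸ (2 + 2 * k′))   ∎)
    where
    open ≤-Reasoning
    double-* : ∀ x y → (x + x) * y ≡ 2 * (x * y)
    double-* = solve-∀

  2m<p∸1 : 2 * m < p ∸ 1
  2m<p∸1 = 2*[k+⌈s/2⌉]<p∸1 {p} {k′} {s} 2k′<p∸1 s<p∸[2+2k′]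

  m+m<p : m + m < p
  m+m<p = ≤-trans (s≤s (+-monoʳ-≤ m (n≤1+n m))) (2*m<p∸1⇒2+m+m≤p 2m<p∸1)

  m<p : m < p
  m<p = ≤-<-trans (m≤m+n m m) m+m<p

  occurs : Occurs p (H + H) m n k′ l
  occurs = subst (p ∤_) (sym (CartierCoeff-at p H {n} {k′} {l} {j} (⌊n/2⌋≤⌈n/2⌉ s) H[j+⌊s/2⌋]+n+1≡p[l+1]))
    (prime∤* pp (prime∤nCk pp m<p (m≤m+n k′ j)) (prime∤nCk pp j<p (⌊n/2⌋≤⌈n/2⌉ s)))
    where
    j<p : j < p
    j<p = ≤-<-trans (m≤n+m j k′) m<p
    H[j+⌊s/2⌋]+n+1≡p[l+1] : H * (j + ⌊ s /2⌋) + n + 1 ≡ p * (l + 1)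
    H[j+⌊s/2⌋]+n+1≡p[l+1] = subst (λ σ → H * σ + n + 1 ≡ p * (l + 1))
      (sym (trans (+-comm j ⌊ s /2⌋) (⌊n/2⌋+⌈n/2⌉≡n s))) Hs+n+1≡p[l+1]

  contributes⇒≤lex : ∀ {a i t b} → a + i ≡ m → t ≤ i → H * (i + t) + n + 1 ≡ p * (b + 1) → (a , b) ≤lex (k′ , l)
  contributes⇒≤lex {a} {i} {t} {b} a+i≡m t≤i exponent = ≤×≡⇒≤lex (+-cancelʳ-≤ i a k′ a+i≤k′+i) (proj₂ i+t≡s×b≡l)
    where
    i≤m : i ≤ m
    i≤m = subst (i ≤_) a+i≡m (m≤n+m i a)
    i+t<p : i + t < p
    i+t<p = ≤-<-trans (+-mono-≤ i≤m (≤-trans t≤i i≤m)) m+m<p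
    s<p : s < p
    s<p = <-≤-trans s<p∸[2+2k′] (m∸n≤m p (2 + 2 * k′))
    i+t≡s×b≡l : i + t ≡ s × b ≡ l
    i+t≡s×b≡l = exponent-unique {p} {H} {i + t} {s} {n} p*p≡1+2H i+t<p s<p exponent Hs+n+1≡p[l+1]
    j≤i : j ≤ i
    j≤i = subst (λ σ → ⌈ σ /2⌉ ≤ i) (proj₁ i+t≡s×b≡l) (⌈[i+t]/2⌉≤i t≤i)
    a+i≤k′+i : a + i ≤ k′ + i
    a+i≤k′+i = subst (_≤ k′ + i) (sym a+i≡m) (+-monoʳ-≤ k′ j≤i)

  maximal : ∀ a b → Occurs p (H + H) m n a b → (a , b) ≤lex (k′ , l)
  maximal a b occ =
    let i , t , a+i≡m , t≤i , exponent = CartierCoeff-≢0 p H m n a b (λ c≡0 → occ (subst (p ∣_) (sym c≡0) (p ∣0)))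
    in contributes⇒≤lex a+i≡m t≤i exponent

  largestTerm : Σ ℕ λ m → Σ ℕ λ n → InBasis p (H + H) m n × (2 * m < p ∸ 1) × LargestTerm p (H + H) m n k′ l
  largestTerm = m , n , InBasis-intro p*p≡1+2H 2m<p∸1 (m%n<n _ H) , 2m<p∸1 , occurs , maximal

lemma2p11 : (p : ℕ) → .{{_ : NonZero p}} → Prime p → p ≢ 2 →
              (k′ l : ℕ) → 2 * k′ < p ∸ 1 →
              2 * p * (l + 1) ≤ (p ^ 2 ∸ 1) * (p ∸ (2 + 2 * k′)) →
              Σ ℕ (λ m → Σ ℕ (λ n →
                InBasis p (p ^ 2 ∸ 1) m n × (2 * m < p ∸ 1) ×
                LargestTerm p (p ^ 2 ∸ 1) m n k′ l))
lemma2p11 p pp p≢2 k′ l 2k′<p∸1 bound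
  with H , H≢0 , p*p≡1+2H ← odd-prime-square pp p≢2
  rewrite cong (_∸ 1) (trans (cong (p *_) (*-identityʳ p)) p*p≡1+2H)
  = LargestTermWitness.largestTerm {{_}} {{H≢0}} pp p*p≡1+2H 2k′<p∸1 bound
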